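{- Let $D$ be a digraph each of whose weak components has a source. If for some integer $m \geq 2$ each component of the $m$-step competition graph $C^m(D)$ is triangle-free and contains a source of $D$, then each weak component of $D$ is a star-generating digraph.
   Context: All digraphs are finite, may have loops, and (standing assumption) every vertex has outdegree at least $1$. For a positive integer $m$, a vertex $y$ is an $m$-step prey of $x$ if there is a directed walk of length $m$ from $x$ to $y$; $1$-step prey/predators are called prey/predators. The $m$-step competition graph $C^m(D)$ has vertex set $V(D)$ and an edge between distinct vertices $x,y$ iff they have a common $m$-step prey. A source is a vertex of indegree $0$. $D$ is weakly connected if its underlying undirected graph is connected; a weak component is the subdigraph induced by a component of the underlying graph. A weakly connected digraph $D$ is star-generating if: ($S_1$) $D$ has at least one source and, for each source $v$, each prey of $v$ has exactly two predators; ($S_2$) no two sources of $D$ have a common prey; ($S_3$) each non-source vertex has exactly one prey and exactly two predators, one of which is a source and the other of which is a non-source vertex. -}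

module Defs where

open import Data.Nat using (ℕ; zero; suc)
open import Data.Fin using (Fin)
open import Data.Bool using (Bool; T)
open import Data.Product using (Σ; ∃; _×_; _,_; proj₁)
open import Data.Sum using (_⊎_)
open import Relation.Binary.PropositionalEquality using (_≡_; _≢_)
open import Relation.Nullary using (¬_)
open import Relation.Binary.Construct.Closure.ReflexiveTransitive using (Star)

-- A finite digraph on vertex set Fin n (loops allowed), given by its
-- Boolean adjacency matrix: D x y = true iff (x , y) is an arc.
Digraph : ℕ → Set
Digraph n = Fin n → Fin n → Bool

Arc : ∀ {n} → Digraph n → Fin n → Fin n → Set
Arc D x y = T (D x y)

-- Standing assumption: every vertex has outdegree at least 1.
OutdegPos : ∀ {n} → Digraph n → Set
OutdegPos {n} D = (x : Fin n) → ∃ λ y → Arc D x y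

data Walk {V : Set} (A : V → V → Set) : ℕ → V → V → Set where
  here : ∀ {x} → Walk A zero x x
  step : ∀ {m x y z} → A x y → Walk A m y z → Walk A (suc m) x z

MPrey : ∀ {n} → Digraph n → ℕ → Fin n → Fin n → Set
MPrey D m x y = Walk (Arc D) m x y

CmEdge : ∀ {n} → Digraph n → ℕ → Fin n → Fin n → Set
CmEdge D m x y = x ≢ y × ∃ λ z → MPrey D m x z × MPrey D m y z

CmConn : ∀ {n} → Digraph n → ℕ → Fin n → Fin n → Set
CmConn D m = Star (CmEdge D m)

SymRel : {V : Set} → (V → V → Set) → V → V → Set
SymRel A x y = A x y ⊎ A y x

WConn : ∀ {n} → Digraph n → Fin n → Fin n → Set
WConn D = Star (SymRel (Arc D))

Source : ∀ {n} → Digraph n → Fin n → Set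
Source D x = ∀ y → ¬ Arc D y x

-- Star-generating, for the subdigraph induced by a vertex set P of a
-- digraph with arc relation A (everything relativised to P).

module Induced {V : Set} (A : V → V → Set) (P : V → Set) where

  ArcP : Σ V P → Σ V P → Set
  ArcP x y = A (proj₁ x) (proj₁ y)

  WeaklyConnected : Set
  WeaklyConnected = (x y : Σ V P) → Star (SymRel ArcP) x y

  IsSource : V → Set
  IsSource x = P x × (∀ y → P y → ¬ A y x)

  ExactlyTwoPredators : V → Set
  ExactlyTwoPredators y =
    ∃ λ a → ∃ λ b → a ≢ b × P a × P b × A a y × A b y ×
      (∀ c → P c → A c y → c ≡ a ⊎ c ≡ b)

  S₁ : Set
  S₁ = (∃ λ v → IsSource v) ×
       (∀ v → IsSource v → ∀ y → P y → A v y → ExactlyTwoPredators y)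

  S₂ : Set
  S₂ = ∀ u v → IsSource u → IsSource v → u ≢ v →
       ¬ (∃ λ y → P y × A u y × A v y)

  S₃ : Set
  S₃ = ∀ x → P x → ¬ IsSource x →
       (∃ λ y → P y × A x y × (∀ z → P z → A x z → z ≡ y)) ×
       (∃ λ a → ∃ λ b → P a × P b × IsSource a × ¬ IsSource b ×
          A a x × A b x × (∀ c → P c → A c x → c ≡ a ⊎ c ≡ b))

  StarGenerating : Set
  StarGenerating = WeaklyConnected × S₁ × S₂ × S₃

WeakComponentStarGenerating : ∀ {n} → Digraph n → Fin n → Set
WeakComponentStarGenerating D v = Induced.StarGenerating (Arc D) (WConn D v)

-- Triangle-freeness of C^m(D) means that no vertex is a common
-- m-step prey of three distinct vertices, so every vertex accounts for at most one
-- edge of C^m(D), and a source for none. Since every component of C^m(D) contains a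
-- source, C^m(D) has at least n − #sources edges; hence every non-source has exactly
-- two m-step predators, and distinct non-sources have distinct pairs of them.
-- Next, no non-source can have a single (m − 1)-step predator x: that property would
-- pass from x to its neighbours in C^m(D) and so reach a source. Two distinct
-- (m − 1)-step predators of every non-source force a unique prey and a unique
-- non-source predator, and tracing walks backwards yields a source predator.

module Submission where

open import Data.Bool using (true; false; if_then_else_)
open import Data.Empty using (⊥; ⊥-elim)
open import Data.Fin using (Fin)
open import Data.Fin.Properties using (_≟_; any?; all?; injective⇒≤)
open import Data.List using (List; []; _∷_; length; filter; mapMaybe; allFin)
open import Data.List.Membership.Propositional using (_∈_)
open import Data.List.Membership.Propositional.Properties using (∈-allFin; ∈-filter⁺)
open import Data.List.Membership.Setoid.Properties using (index-injective)
open import Data.List.Properties using (length-tabulate)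
open import Data.List.Relation.Unary.Any using (here; there)
open import Data.Maybe using (Maybe; just; nothing)
open import Data.Nat using (ℕ; zero; suc; _+_; _≤_; _<_; z≤n; s≤s)
open import Data.Nat.Properties using (+-suc; +-identityʳ; n≤1+n; ≤-refl; ≤-trans; <-irrefl; module ≤-Reasoning)
open import Data.Product using (∃; _×_; _,_; proj₁; proj₂)
open import Data.Sum using (_⊎_; inj₁; inj₂)
import Data.Sum as Sum
open import Function using (_∘_)
open import Relation.Binary using (_⇒_)
open import Relation.Binary.Construct.Closure.ReflexiveTransitive using (Star; ε; _◅_; _◅◅_)
import Relation.Binary.Construct.Closure.ReflexiveTransitive as Star
open import Relation.Binary.PropositionalEquality using (_≡_; _≢_; refl; sym; trans; subst; setoid)
open import Relation.Nullary using (¬_; Dec; yes; no)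
open import Relation.Nullary.Decidable using (_×-dec_; ¬?; T?; does; dec-true; dec-false)
open import Relation.Unary using (Decidable)

open import Defs

module _ {V : Set} {A : V → V → Set} where

  snoc : ∀ {k x y z} → Walk A k x y → A y z → Walk A (suc k) x z
  snoc here y→z = step y→z here
  snoc (step x→x′ w) y→z = step x→x′ (snoc w y→z)

  unsnoc : ∀ {k x z} → Walk A (suc k) x z → ∃ λ y → Walk A k x y × A y z
  unsnoc (step x→z here) = _ , here , x→z
  unsnoc (step x→x′ w@(step _ _)) with unsnoc w
  ... | y , w′ , y→z = y , step x→x′ w′ , y→z

  walkFrom : (∀ x → ∃ (A x)) → ∀ k x → ∃ (Walk A k x)
  walkFrom out zero x = x , here
  walkFrom out (suc k) x with out x
  ... | y , x→y with walkFrom out k y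
  ... | z , w = z , step x→y w

walk? : ∀ {n} {A : Fin n → Fin n → Set} → (∀ x y → Dec (A x y)) → ∀ k x y → Dec (Walk A k x y)
walk? A? zero x y with x ≟ y
... | yes refl = yes here
... | no x≢y = no λ { here → x≢y refl }
walk? A? (suc k) x y with any? (λ x′ → A? x x′ ×-dec walk? A? k x′ y)
... | yes (x′ , x→x′ , w) = yes (step x→x′ w)
... | no ∄ = no λ { (step x→x′ w) → ∄ (_ , x→x′ , w) }

∈-mapMaybe⁺ : ∀ {A B : Set} {f : A → Maybe B} {x y xs} → x ∈ xs → f x ≡ just y → y ∈ mapMaybe f xs
∈-mapMaybe⁺ (here refl) fx≡y rewrite fx≡y = here refl
∈-mapMaybe⁺ {f = f} {xs = x ∷ _} (there x∈xs) fx≡y with f x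
... | just _ = there (∈-mapMaybe⁺ x∈xs fx≡y)
... | nothing = ∈-mapMaybe⁺ x∈xs fx≡y

module _ {n : ℕ} where

  Linked : List (Fin n × Fin n) → Fin n → Fin n → Set
  Linked E x y = (x , y) ∈ E ⊎ (y , x) ∈ E

  Rooted : List (Fin n) → List (Fin n × Fin n) → Set
  Rooted S E = ∀ x → ∃ λ s → s ∈ S × Star (Linked E) x s

  complete⇒n≤length : ∀ {S} → (∀ x → x ∈ S) → n ≤ length S
  complete⇒n≤length ∈S = injective⇒≤ λ {x} {y} → index-injective (setoid (Fin n)) (∈S x) (∈S y)

  module _ {u w : Fin n} {E : List (Fin n × Fin n)} where

    private
      R = Linked E
      R′ = Linked ((u , w) ∷ E)

      prepend : ∀ {x y s} → R x y → Star R y s ⊎ Star R y u ⊎ Star R y w → Star R x s ⊎ Star R x u ⊎ Star R x w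
      prepend e = Sum.map (e ◅_) (Sum.map (e ◅_) (e ◅_))

    cutAtFirstUse : ∀ {x s} → Star R′ x s → Star R x s ⊎ Star R x u ⊎ Star R x w
    cutAtFirstUse ε = inj₁ ε
    cutAtFirstUse (inj₁ (here refl) ◅ _) = inj₂ (inj₁ ε)
    cutAtFirstUse (inj₂ (here refl) ◅ _) = inj₂ (inj₂ ε)
    cutAtFirstUse (inj₁ (there e) ◅ p) = prepend (inj₁ e) (cutAtFirstUse p)
    cutAtFirstUse (inj₂ (there e) ◅ p) = prepend (inj₂ e) (cutAtFirstUse p)

    cutAtLastUse : ∀ {s} → Star R′ u s → Star R u s ⊎ Star R w s
    cutAtLastUse p with cutAtFirstUse (Star.reverse Sum.swap p)
    ... | inj₁ q = inj₁ (Star.reverse Sum.swap q)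
    ... | inj₂ (inj₁ q) = inj₁ (Star.reverse Sum.swap q)
    ... | inj₂ (inj₂ q) = inj₂ (Star.reverse Sum.swap q)

    rooted-swap : ∀ {S} → Rooted S ((u , w) ∷ E) → Rooted S ((w , u) ∷ E)
    rooted-swap rooted x with rooted x
    ... | s , s∈S , p = s , s∈S , Star.map swapHead p
      where
      swapHead : Linked ((u , w) ∷ E) ⇒ Linked ((w , u) ∷ E)
      swapHead (inj₁ (here refl)) = inj₂ (here refl)
      swapHead (inj₂ (here refl)) = inj₁ (here refl)
      swapHead (inj₁ (there e)) = inj₁ (there e)
      swapHead (inj₂ (there e)) = inj₂ (there e)

    rooted-reroot : ∀ {S s} → s ∈ S → Star R u s → Rooted S ((u , w) ∷ E) → Rooted (w ∷ S) E
    rooted-reroot {s = s} s∈S u⇝s rooted x with rooted x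
    ... | t , t∈S , x⇝t with cutAtFirstUse x⇝t
    ... | inj₁ x⇝t′ = t , there t∈S , x⇝t′
    ... | inj₂ (inj₁ x⇝u) = s , there s∈S , x⇝u ◅◅ u⇝s
    ... | inj₂ (inj₂ x⇝w) = w , here refl , x⇝w

  rooted-removeEdge : ∀ {u w S E} → Rooted S ((u , w) ∷ E) → Rooted (w ∷ S) E ⊎ Rooted (u ∷ S) E
  rooted-removeEdge {u} rooted with rooted u
  ... | s , s∈S , u⇝s with cutAtLastUse u⇝s
  ... | inj₁ u⇝s′ = inj₁ (rooted-reroot s∈S u⇝s′ rooted)
  ... | inj₂ w⇝s′ = inj₂ (rooted-reroot s∈S w⇝s′ (rooted-swap rooted))

  n≤roots+edges : ∀ E S → Rooted S E → n ≤ length S + length E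
  n≤roots+edges [] S rooted = subst (n ≤_) (sym (+-identityʳ _)) (complete⇒n≤length λ x → root∈S (rooted x))
    where
    root∈S : ∀ {x} → (∃ λ s → s ∈ S × Star (Linked []) x s) → x ∈ S
    root∈S (_ , s∈S , ε) = s∈S
    root∈S (_ , _ , inj₁ () ◅ _)
    root∈S (_ , _ , inj₂ () ◅ _)
  n≤roots+edges ((u , w) ∷ E) S rooted rewrite +-suc (length S) (length E)
    with rooted-removeEdge rooted
  ... | inj₁ rooted′ = n≤roots+edges E (w ∷ S) rooted′
  ... | inj₂ rooted′ = n≤roots+edges E (u ∷ S) rooted′

module _ {n : ℕ} {Root : Fin n → Set} (Root? : Decidable Root)
         (charge : Fin n → Maybe (Fin n × Fin n))
         (root-uncharged : ∀ x → Root x → charge x ≡ nothing) where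

  private
    tally : List (Fin n) → ℕ
    tally xs = length (filter Root? xs) + length (mapMaybe charge xs)

    tally-∷ : ∀ x xs → tally (x ∷ xs) ≤ suc (tally xs)
    tally-∷ x xs with Root? x
    ... | yes root rewrite root-uncharged x root = ≤-refl
    ... | no _ with charge x
    ...   | just _ rewrite +-suc (length (filter Root? xs)) (length (mapMaybe charge xs)) = ≤-refl
    ...   | nothing = n≤1+n _

    tally≤length : ∀ xs → tally xs ≤ length xs
    tally≤length [] = z≤n
    tally≤length (x ∷ xs) = ≤-trans (tally-∷ x xs) (s≤s (tally≤length xs))

    tally<length : ∀ {v} xs → v ∈ xs → ¬ Root v → charge v ≡ nothing → tally xs < length xs
    tally<length (x ∷ xs) (here refl) ¬root uncharged with Root? x
    ... | yes root = ⊥-elim (¬root root)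
    ... | no _ rewrite uncharged = s≤s (tally≤length xs)
    tally<length (x ∷ xs) (there v∈xs) ¬root uncharged =
      ≤-trans (s≤s (tally-∷ x xs)) (s≤s (tally<length xs v∈xs ¬root uncharged))

  -- Every vertex reaching a root forces at least n − #roots edges, but charge supplies
  -- at most one edge per non-root, and none at an uncharged one.
  nonRoot-charged : ∀ {R : Fin n → Fin n → Set} → R ⇒ Linked (mapMaybe charge (allFin n)) →
                    (∀ x → ∃ λ s → Star R x s × Root s) → ∀ {v} → ¬ Root v → charge v ≢ nothing
  nonRoot-charged covered reachesRoot {v} ¬root uncharged = <-irrefl refl (begin-strict
    n                  ≤⟨ n≤roots+edges _ _ rooted ⟩
    tally (allFin n)   <⟨ tally<length (allFin n) (∈-allFin v) ¬root uncharged ⟩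
    length (allFin n)  ≡⟨ length-tabulate (λ x → x) ⟩
    n                  ∎)
    where
    open ≤-Reasoning
    rooted : Rooted (filter Root? (allFin n)) (mapMaybe charge (allFin n))
    rooted x with reachesRoot x
    ... | s , x⇝s , root = s , ∈-filter⁺ Root? (∈-allFin s) root , Star.map covered x⇝s

module _ {n : ℕ} (D : Digraph n) where

  HasPredator : Fin n → Set
  HasPredator y = ∃ λ x → Arc D x y

  HasTwoPredators : ℕ → Fin n → Set
  HasTwoPredators m w = ∃ λ a → ∃ λ b → a ≢ b × MPrey D m a w × MPrey D m b w

  NoThreePredators : ℕ → Set
  NoThreePredators m = ∀ {w a b c} → a ≢ b → b ≢ c → a ≢ c →
                       MPrey D m a w → MPrey D m b w → MPrey D m c w → ⊥

  SourceInEveryComponent : ℕ → Set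
  SourceInEveryComponent m = ∀ v → ∃ λ s → CmConn D m v s × Source D s

  arc? : ∀ x y → Dec (Arc D x y)
  arc? x y = T? (D x y)

  source? : ∀ x → Dec (Source D x)
  source? x = all? λ y → ¬? (arc? y x)

  source⊎hasPredator : ∀ y → Source D y ⊎ HasPredator y
  source⊎hasPredator y with any? (λ x → arc? x y)
  ... | yes predator = inj₂ predator
  ... | no ∄ = inj₁ λ x x→y → ∄ (x , x→y)

  source-¬hasPredator : ∀ {y} → Source D y → ¬ HasPredator y
  source-¬hasPredator source (x , x→y) = source x x→y

  source≢hasPredator : ∀ {s p} → Source D s → HasPredator p → s ≢ p
  source≢hasPredator source hp refl = source-¬hasPredator source hp

  walkEnd-hasPredator : ∀ {j x y} → MPrey D (suc j) x y → HasPredator y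
  walkEnd-hasPredator w with unsnoc w
  ... | y′ , _ , y′→y = y′ , y′→y

  twoPredators? : ∀ m w → Dec (HasTwoPredators m w)
  twoPredators? m w = any? λ a → any? λ b → ¬? (a ≟ b) ×-dec walk? arc? m a w ×-dec walk? arc? m b w

  source-noTwoPredators : ∀ {m w} → Source D w → ¬ HasTwoPredators m w
  source-noTwoPredators {zero} _ (_ , _ , a≢b , here , here) = a≢b refl
  source-noTwoPredators {suc m} source (_ , _ , _ , wa , _) = source-¬hasPredator source (walkEnd-hasPredator wa)

module Competition {n : ℕ} (D : Digraph n) {m : ℕ} (noThree : NoThreePredators D m) where

  third-predator : ∀ {w a b c} → a ≢ b → MPrey D m a w → MPrey D m b w → MPrey D m c w → c ≡ a ⊎ c ≡ b
  third-predator {a = a} {b} {c} a≢b wa wb wc with c ≟ a | c ≟ b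
  ... | yes c≡a | _ = inj₁ c≡a
  ... | no _ | yes c≡b = inj₂ c≡b
  ... | no c≢a | no c≢b = ⊥-elim (noThree a≢b (c≢b ∘ sym) (c≢a ∘ sym) wa wb wc)

  module Pairs (rooted : SourceInEveryComponent D m) where

    private
      Charge : Set
      Charge = Fin n → Maybe (Fin n × Fin n)

      edges : Charge → List (Fin n × Fin n)
      edges charge = mapMaybe charge (allFin n)

      pairOf : ∀ {w} → Dec (HasTwoPredators D m w) → Maybe (Fin n × Fin n)
      pairOf (yes (a , b , _)) = just (a , b)
      pairOf (no _) = nothing

      -- By noThree, the m-step predators of w span at most one edge of C^m(D): this pair.
      chosenPair : Charge
      chosenPair w = pairOf (twoPredators? D m w)

      pairOf-just : ∀ {w} (d : Dec (HasTwoPredators D m w)) → HasTwoPredators D m w →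
                    ∃ λ a → ∃ λ b → pairOf d ≡ just (a , b) × a ≢ b × MPrey D m a w × MPrey D m b w
      pairOf-just (yes (a , b , two)) _ = a , b , refl , two
      pairOf-just (no ¬two) two = ⊥-elim (¬two two)

      pairOf-no : ∀ {w} (d : Dec (HasTwoPredators D m w)) → ¬ HasTwoPredators D m w → pairOf d ≡ nothing
      pairOf-no (yes two) ¬two = ⊥-elim (¬two two)
      pairOf-no (no _) _ = refl

      chosenPair-source : ∀ x → Source D x → chosenPair x ≡ nothing
      chosenPair-source x source = pairOf-no (twoPredators? D m x) (source-noTwoPredators D source)

      linked-viaChosenPair : ∀ {charge z x y} → charge z ≡ chosenPair z → HasTwoPredators D m z →
                             x ≢ y → MPrey D m x z → MPrey D m y z → Linked (edges charge) x y
      linked-viaChosenPair {z = z} chosen two x≢y wx wy with pairOf-just (twoPredators? D m z) two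
      ... | a , b , paired , a≢b , wa , wb
          with third-predator a≢b wa wb wx | third-predator a≢b wa wb wy
      ... | inj₁ refl | inj₂ refl = inj₁ (∈-mapMaybe⁺ (∈-allFin z) (trans chosen paired))
      ... | inj₂ refl | inj₁ refl = inj₂ (∈-mapMaybe⁺ (∈-allFin z) (trans chosen paired))
      ... | inj₁ refl | inj₁ refl = ⊥-elim (x≢y refl)
      ... | inj₂ refl | inj₂ refl = ⊥-elim (x≢y refl)

    hasPredator⇒twoPredators : ∀ {w} → HasPredator D w → HasTwoPredators D m w
    hasPredator⇒twoPredators {w} (p , p→w) with twoPredators? D m w
    ... | yes two = two
    ... | no ¬two = ⊥-elim (nonRoot-charged (source? D) chosenPair chosenPair-source covered rooted
                              (λ source → source p p→w) (pairOf-no (twoPredators? D m w) ¬two))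
      where
      covered : CmEdge D m ⇒ Linked (edges chosenPair)
      covered (x≢y , _ , wx , wy) = linked-viaChosenPair refl (_ , _ , x≢y , wx , wy) x≢y wx wy

    twoPredators-samePrey : ∀ {w w′ a b} → a ≢ b → MPrey D m a w → MPrey D m b w →
                            MPrey D m a w′ → MPrey D m b w′ → w ≡ w′
    twoPredators-samePrey {w} {w′} a≢b wa wb wa′ wb′ with w ≟ w′
    ... | yes w≡w′ = w≡w′
    ... | no w≢w′ = ⊥-elim (nonRoot-charged (source? D) charge charge-source covered rooted
                              (λ source → source-noTwoPredators D source (_ , _ , a≢b , wa′ , wb′))
                              charge-w′)
      where
      -- w and w′ share their pair of m-step predators, so w′ may go uncharged.
      charge : Charge
      charge x = if does (x ≟ w′) then nothing else chosenPair x

      charge-w′ : charge w′ ≡ nothing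
      charge-w′ rewrite dec-true (w′ ≟ w′) refl = refl

      charge-other : ∀ {x} → x ≢ w′ → charge x ≡ chosenPair x
      charge-other x≢w′ rewrite dec-false (_ ≟ w′) x≢w′ = refl

      charge-source : ∀ x → Source D x → charge x ≡ nothing
      charge-source x source with does (x ≟ w′)
      ... | true = refl
      ... | false = chosenPair-source x source

      predator-of-w : ∀ {x} → MPrey D m x w′ → MPrey D m x w
      predator-of-w wx with third-predator a≢b wa′ wb′ wx
      ... | inj₁ refl = wa
      ... | inj₂ refl = wb

      covered : CmEdge D m ⇒ Linked (edges charge)
      covered (x≢y , z , wx , wy) with z ≟ w′
      ... | no z≢w′ = linked-viaChosenPair (charge-other z≢w′) (_ , _ , x≢y , wx , wy) x≢y wx wy
      ... | yes refl = linked-viaChosenPair (charge-other w≢w′) (_ , _ , a≢b , wa , wb)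
                         x≢y (predator-of-w wx) (predator-of-w wy)

module WeakComponent {n : ℕ} (D : Digraph n) (v : Fin n) where
  open Induced (Arc D) (WConn D v)

  wconn-step : ∀ {x y} → WConn D v x → SymRel (Arc D) x y → WConn D v y
  wconn-step v⇝x e = v⇝x ◅◅ Star.return e

  wconn-prey : ∀ {x y} → WConn D v x → Arc D x y → WConn D v y
  wconn-prey v⇝x x→y = wconn-step v⇝x (inj₁ x→y)

  wconn-predator : ∀ {x y} → WConn D v y → Arc D x y → WConn D v x
  wconn-predator v⇝y x→y = wconn-step v⇝y (inj₂ x→y)

  isSource⇒source : ∀ {u} → IsSource u → Source D u
  isSource⇒source (v⇝u , no-arc) x x→u = no-arc x (wconn-predator v⇝u x→u) x→u

  source⇒isSource : ∀ {u} → WConn D v u → Source D u → IsSource u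
  source⇒isSource v⇝u source = v⇝u , λ x _ → source x

  weaklyConnected : OutdegPos D → WeaklyConnected
  weaklyConnected out (x , v⇝x) (y , v⇝y) = lift (Star.reverse Sum.swap v⇝x ◅◅ v⇝y) v⇝x v⇝y
    where
    -- Membership proofs are not unique, so even u = u′ needs a detour along an arc.
    revisit : ∀ {u} (v⇝u v⇝u′ : WConn D v u) → Star (SymRel ArcP) (u , v⇝u) (u , v⇝u′)
    revisit {u} v⇝u v⇝u′ with out u
    ... | u′ , u→u′ = _◅_ {j = u′ , wconn-prey v⇝u u→u′} (inj₁ u→u′) (Star.return (inj₂ u→u′))

    lift : ∀ {u u′} → Star (SymRel (Arc D)) u u′ →
           (v⇝u : WConn D v u) (v⇝u′ : WConn D v u′) → Star (SymRel ArcP) (u , v⇝u) (u′ , v⇝u′)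
    lift ε v⇝u v⇝u′ = revisit v⇝u v⇝u′
    lift (e ◅ p) v⇝u v⇝u′ = e ◅ lift p (wconn-step v⇝u e) v⇝u′

module TriangleFreeCompetition {n : ℕ} (D : Digraph n) (out : OutdegPos D) (k : ℕ)
    (noThree : NoThreePredators D (2 + k)) (rooted : SourceInEveryComponent D (2 + k)) where

  open Competition D noThree
  open Pairs rooted

  private
    _⟶_ : Fin n → Fin n → Set
    _⟶_ = Arc D

  third-arc : ∀ {w a b c} → a ≢ b → a ⟶ w → b ⟶ w → c ⟶ w → c ≡ a ⊎ c ≡ b
  third-arc {w} a≢b a→w b→w c→w with walkFrom out (1 + k) w
  ... | _ , w⇝ = third-predator a≢b (step a→w w⇝) (step b→w w⇝) (step c→w w⇝)

  nonSourcePredator : ∀ {w} → HasPredator D w → ∃ λ p → p ⟶ w × HasPredator D p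
  nonSourcePredator hw with hasPredator⇒twoPredators hw
  ... | a , _ , _ , wa , _ with unsnoc wa
  ... | p , a⇝p , p→w = p , p→w , walkEnd-hasPredator D a⇝p

  walkInto : ∀ {p} → HasPredator D p → ∀ j → ∃ λ x → MPrey D j x p
  walkInto _ zero = _ , here
  walkInto hp (suc j) with nonSourcePredator hp
  ... | p′ , p′→p , hp′ with walkInto hp′ j
  ... | x , x⇝p′ = x , snoc x⇝p′ p′→p

  solePredator⇒solePrey : ∀ {y p z} → HasPredator D y → (∀ y′ → y′ ⟶ y → HasPredator D y′ → y′ ≡ p) →
                          p ⟶ z → z ≡ y
  solePredator⇒solePrey hy sole p→z with hasPredator⇒twoPredators hy
  ... | a , b , a≢b , wa , wb with unsnoc wa | unsnoc wb
  ... | a′ , a⇝a′ , a′→y | b′ , b⇝b′ , b′→y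
      with sole a′ a′→y (walkEnd-hasPredator D a⇝a′) | sole b′ b′→y (walkEnd-hasPredator D b⇝b′)
  ... | refl | refl = twoPredators-samePrey a≢b (snoc a⇝a′ p→z) (snoc b⇝b′ p→z) wa wb

  soleWalkPredator⇒soleWalkPrey : ∀ j {a q} → HasPredator D a → (∀ x → MPrey D j x a → x ≡ q) →
                                  ∀ {y} → MPrey D j q y → y ≡ a
  soleWalkPredator⇒soleWalkPrey zero _ sole here = sym (sole _ here)
  soleWalkPredator⇒soleWalkPrey (suc j) {a} {q} ha sole w with unsnoc w | nonSourcePredator ha
  ... | y′ , q⇝y′ , y′→y | p , p→a , hp = solePredator⇒solePrey ha p-sole (subst (_⟶ _) (q⇝-p q⇝y′) y′→y)
    where
    q⇝-p : ∀ {y} → MPrey D j q y → y ≡ p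
    q⇝-p = soleWalkPredator⇒soleWalkPrey j hp λ x x⇝p → sole x (snoc x⇝p p→a)

    p-sole : ∀ y″ → y″ ⟶ a → HasPredator D y″ → y″ ≡ p
    p-sole y″ y″→a hy″ with walkInto hy″ j
    ... | x , x⇝y″ with sole x (snoc x⇝y″ y″→a)
    ... | refl = q⇝-p x⇝y″

  OnlyPredator : Fin n → Set
  OnlyPredator x = ∃ λ a → HasPredator D a × (∀ c → MPrey D (1 + k) c a → c ≡ x)

  onlyPredator-hasPredator : ∀ {x} → OnlyPredator x → HasPredator D x
  onlyPredator-hasPredator (_ , ha , sole) with walkInto ha (2 + k)
  ... | c , step {y = c′} c→c′ c′⇝a with sole c′ c′⇝a
  ... | refl = c , c→c′

  onlyPredator-step : ∀ {x y} → OnlyPredator x → CmEdge D (2 + k) x y → OnlyPredator y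
  onlyPredator-step {x} {y} (a , ha , sole) (x≢y , z , x⇝z , y⇝z) with unsnoc y⇝z
  ... | b , y⇝b , b→z = b , walkEnd-hasPredator D y⇝b , b-sole
    where
    b-sole : ∀ c → MPrey D (1 + k) c b → c ≡ y
    b-sole c c⇝b with c ≟ y | c ≟ x
    ... | yes c≡y | _ = c≡y
    ... | no _ | yes refl = ⊥-elim (x≢y (sym (sole y
            (subst (MPrey D (1 + k) y) (soleWalkPredator⇒soleWalkPrey (1 + k) ha sole c⇝b) y⇝b))))
    ... | no c≢y | no c≢x = ⊥-elim (noThree x≢y (c≢y ∘ sym) (c≢x ∘ sym) x⇝z y⇝z (snoc c⇝b b→z))

  onlyPredator-reach : ∀ {x s} → OnlyPredator x → CmConn D (2 + k) x s → OnlyPredator s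
  onlyPredator-reach only ε = only
  onlyPredator-reach only (e ◅ p) = onlyPredator-reach (onlyPredator-step only e) p

  ¬onlyPredator : ∀ {x} → ¬ OnlyPredator x
  ¬onlyPredator {x} only with rooted x
  ... | s , x⇝s , source = source-¬hasPredator D source (onlyPredator-hasPredator (onlyPredator-reach only x⇝s))

  hasPredator⇒twoShorterPredators : ∀ {a} → HasPredator D a → HasTwoPredators D (1 + k) a
  hasPredator⇒twoShorterPredators {a} ha with twoPredators? D (1 + k) a
  ... | yes two = two
  ... | no ¬two with walkInto ha (1 + k)
  ...   | q , q⇝a = ⊥-elim (¬onlyPredator (a , ha , q-sole))
    where
    q-sole : ∀ c → MPrey D (1 + k) c a → c ≡ q
    q-sole c c⇝a with c ≟ q
    ... | yes c≡q = c≡q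
    ... | no c≢q = ⊥-elim (¬two (c , q , c≢q , c⇝a , q⇝a))

  nonSource-uniquePrey : ∀ {x y z} → HasPredator D x → x ⟶ y → x ⟶ z → y ≡ z
  nonSource-uniquePrey hx x→y x→z with hasPredator⇒twoShorterPredators hx
  ... | a , b , a≢b , a⇝x , b⇝x =
    twoPredators-samePrey a≢b (snoc a⇝x x→y) (snoc b⇝x x→y) (snoc a⇝x x→z) (snoc b⇝x x→z)

  nonSourcePredators-equal : ∀ {p p′ w} → HasPredator D p → HasPredator D p′ → p ⟶ w → p′ ⟶ w → p ≡ p′
  nonSourcePredators-equal {p} {p′} hp hp′ p→w p′→w
    with hasPredator⇒twoPredators hp | hasPredator⇒twoShorterPredators hp′
  ... | a , b , a≢b , a⇝p , b⇝p | c , d , c≢d , c⇝p′ , d⇝p′ =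
    twoPredators-samePrey a≢b a⇝p b⇝p (redirect a⇝p) (redirect b⇝p)
    where
    redirect′ : ∀ {x} → MPrey D (1 + k) x p → MPrey D (1 + k) x p′
    redirect′ x⇝p with third-predator c≢d (snoc c⇝p′ p′→w) (snoc d⇝p′ p′→w) (snoc x⇝p p→w)
    ... | inj₁ refl = c⇝p′
    ... | inj₂ refl = d⇝p′

    redirect : ∀ {x} → MPrey D (2 + k) x p → MPrey D (2 + k) x p′
    redirect (step x→x′ x′⇝p) = step x→x′ (redirect′ x′⇝p)

  nonSource-walkSources-equal : ∀ {j v x y} → HasPredator D x → HasPredator D y →
                                MPrey D j x v → MPrey D j y v → x ≡ y
  nonSource-walkSources-equal _ _ here here = refl
  nonSource-walkSources-equal hx hy (step x→x′ x′⇝v) (step y→y′ y′⇝v)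
    with nonSource-walkSources-equal (_ , x→x′) (_ , y→y′) x′⇝v y′⇝v
  ... | refl = nonSourcePredators-equal hx hy x→x′ y→y′

  sourcePredator : ∀ {w} → HasPredator D w → ∃ λ s → s ⟶ w × Source D s
  sourcePredator {w} hw with walkFrom out (1 + k) w
  ... | v , w⇝v with hasPredator⇒twoPredators (walkEnd-hasPredator D w⇝v)
  ... | a , b , a≢b , step a→a′ a′⇝v , step b→b′ b′⇝v
      with nonSource-walkSources-equal (_ , a→a′) hw a′⇝v w⇝v | nonSource-walkSources-equal (_ , b→b′) hw b′⇝v w⇝v
  ... | refl | refl with source⊎hasPredator D a | source⊎hasPredator D b
  ... | inj₁ source-a | _ = a , a→a′ , source-a
  ... | inj₂ _ | inj₁ source-b = b , b→b′ , source-b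
  ... | inj₂ ha | inj₂ hb = ⊥-elim (a≢b (nonSourcePredators-equal ha hb a→a′ b→b′))

  record Predators (w : Fin n) : Set where
    field
      source nonSource : Fin n
      source-isSource : Source D source
      nonSource-hasPredator : HasPredator D nonSource
      source⟶ : source ⟶ w
      nonSource⟶ : nonSource ⟶ w
      onlyThese : ∀ c → c ⟶ w → c ≡ source ⊎ c ≡ nonSource

  predators : ∀ {w} → HasPredator D w → Predators w
  predators hw with sourcePredator hw | nonSourcePredator hw
  ... | s , s→w , source-s | p , p→w , hp = record
    { source = s ; nonSource = p ; source-isSource = source-s ; nonSource-hasPredator = hp
    ; source⟶ = s→w ; nonSource⟶ = p→w
    ; onlyThese = λ c c→w → third-arc (source≢hasPredator D source-s hp) s→w p→w c→w }

  module _ (v : Fin n) where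
    open Induced (Arc D) (WConn D v)
    open WeakComponent D v

    s₁ : (∃ λ s → WConn D v s × Source D s) → S₁
    s₁ (s , v⇝s , source-s) = (s , source⇒isSource v⇝s source-s) , preyHasTwoPredators
      where
      preyHasTwoPredators : ∀ u → IsSource u → ∀ y → WConn D v y → u ⟶ y → ExactlyTwoPredators y
      preyHasTwoPredators _ _ y v⇝y u→y =
        source , nonSource , source≢hasPredator D source-isSource nonSource-hasPredator ,
        wconn-predator v⇝y source⟶ , wconn-predator v⇝y nonSource⟶ , source⟶ , nonSource⟶ , λ c _ → onlyThese c
        where open Predators (predators (_ , u→y))

    s₂ : S₂
    s₂ u u′ isSource-u isSource-u′ u≢u′ (y , _ , u→y , u′→y) with nonSourcePredator (_ , u→y)
    ... | p , p→y , hp with third-arc u≢u′ u→y u′→y p→y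
    ... | inj₁ refl = source-¬hasPredator D (isSource⇒source isSource-u) hp
    ... | inj₂ refl = source-¬hasPredator D (isSource⇒source isSource-u′) hp

    s₃ : S₃
    s₃ x v⇝x ¬isSource with source⊎hasPredator D x
    ... | inj₁ source = ⊥-elim (¬isSource (source⇒isSource v⇝x source))
    ... | inj₂ hx with out x
    ... | y , x→y = (y , wconn-prey v⇝x x→y , x→y , λ z _ x→z → nonSource-uniquePrey hx x→z x→y) ,
                    (source , nonSource , v⇝source , wconn-predator v⇝x nonSource⟶ ,
                     source⇒isSource v⇝source source-isSource ,
                     (λ isSource → source-¬hasPredator D (isSource⇒source isSource) nonSource-hasPredator) ,
                     source⟶ , nonSource⟶ , λ c _ → onlyThese c)
      where
      open Predators (predators hx)
      v⇝source : WConn D v source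
      v⇝source = wconn-predator v⇝x source⟶

    weakComponent-starGenerating : (∃ λ s → WConn D v s × Source D s) → WeakComponentStarGenerating D v
    weakComponent-starGenerating hasSource = weaklyConnected out , s₁ hasSource , s₂ , s₃

corollary3p8 : (n : ℕ) (D : Digraph n) → OutdegPos D →
    (∀ v → ∃ λ s → WConn D v s × Source D s) →
    (m : ℕ) → 2 ≤ m →
    (∀ v → (∀ x y z → CmConn D m v x → CmConn D m v y → CmConn D m v z →
              ¬ (CmEdge D m x y × CmEdge D m y z × CmEdge D m x z))
           × (∃ λ s → CmConn D m v s × Source D s)) →
    ∀ v → WeakComponentStarGenerating D v
corollary3p8 n D out hasSource (suc (suc k)) (s≤s (s≤s z≤n)) components v =
  TriangleFreeCompetition.weakComponent-starGenerating D out k noThree (proj₂ ∘ components) v (hasSource v)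
  where
  noThree : NoThreePredators D (2 + k)
  noThree {w} {a} a≢b b≢c a≢c a⇝w b⇝w c⇝w =
    proj₁ (components a) a _ _ ε (Star.return ab) (Star.return ac) (ab , bc , ac)
    where
    ab = a≢b , w , a⇝w , b⇝w
    bc = b≢c , w , b⇝w , c⇝w
    ac = a≢c , w , a⇝w , c⇝w
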